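{- Let $G$ be a graph and $(N,F)$ a near-far-labeling of $G$. Suppose there exist a partition of $V(G)$ into sets $A, B$ and a set $M \subseteq E(G)$ such that: (i) every edge of $G[A]$ lies in $N$; (ii) every cycle of $G[B]$ contains an even number of edges from $F$; (iii) $M$ is an induced matching (for distinct $e,f \in M$ the vertex sets of $e$ and $f$ are at distance at least $2$ in $G$), and every edge of $M$ joins a vertex of $A$ to a vertex of $B$; (iv) for every pair of edges $ab, a'b \in E(G)\setminus M$ with $a, a' \in A$ and $b \in B$, either both $ab, a'b \in N$ or both $ab, a'b \in F$. Then $G$ admits a $(13,4)$-threshold-coloring with respect to $(N,F)$. Moreover, if $M = \emptyset$, then $G$ admits a $(5,1)$-threshold-coloring with respect to $(N,F)$.
   Context: All graphs are finite, simple and undirected; $G[X]$ denotes the subgraph induced by $X$. A near-far-labeling of $G$ is a pair $(N,F)$ with $N \subseteq E(G)$ and $F = E(G)\setminus N$. For integers $r \geq t$, an $(r,t)$-threshold-coloring of $G$ with respect to $(N,F)$ is a map $c: V(G) \to \{0,\ldots,r-1\}$ with $|c(u)-c(v)| \leq t$ for every $uv \in N$ and $|c(u)-c(v)| > t$ for every $uv \in F$. -}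

module Defs where

open import Data.Bool using (Bool; true; false)
open import Data.Nat using (ℕ; suc; _≤_; _>_; ∣_-_∣; _%_)
open import Data.Nat.DivMod using (m%n<n)
open import Data.Nat.Divisibility using (_∣_)
open import Data.Fin using (Fin; toℕ; fromℕ<)
open import Data.List using (List; allFin; map)
open import Data.Nat.ListAction using (sum)
open import Data.Product using (Σ; _×_; ∃)
open import Function.Definitions using (Injective)
open import Relation.Binary.PropositionalEquality using (_≡_; _≢_)
open import Relation.Nullary using (¬_)

record Graph (n : ℕ) : Set where
  field
    adj     : Fin n → Fin n → Bool
    adj-sym : ∀ u v → adj u v ≡ adj v u
    adj-irr : ∀ u → adj u u ≡ false

-- A near-far-labeling (N , F) of a graph on Fin n: an edge uv is in N iff
-- near u v ≡ true, and in F = E(G) \ N iff near u v ≡ false.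
-- (Values on non-edges are irrelevant.)
record NearFar (n : ℕ) : Set where
  field
    near     : Fin n → Fin n → Bool
    near-sym : ∀ u v → near u v ≡ near v u

open Graph public
open NearFar public

Edge : ∀ {n} → Graph n → Fin n → Fin n → Set
Edge G u v = adj G u v ≡ true

IsThresholdColoring : ∀ {n} (G : Graph n) (L : NearFar n) (r t : ℕ) →
                      (Fin n → Fin r) → Set
IsThresholdColoring G L r t c =
  ∀ u v → Edge G u v →
    (near L u v ≡ true  → ∣ toℕ (c u) - toℕ (c v) ∣ ≤ t) ×
    (near L u v ≡ false → ∣ toℕ (c u) - toℕ (c v) ∣ > t)

HasThresholdColoring : ∀ {n} (G : Graph n) (L : NearFar n) (r t : ℕ) → Set
HasThresholdColoring {n} G L r t =
  Σ (Fin n → Fin r) (IsThresholdColoring G L r t)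

next : ∀ {k} → Fin (suc k) → Fin (suc k)
next {k} i = fromℕ< (m%n<n (suc (toℕ i)) (suc k))

record Cycle {n : ℕ} (G : Graph n) : Set where
  field
    m      : ℕ
    vtx    : Fin (suc (suc (suc m))) → Fin n
    inj    : Injective _≡_ _≡_ vtx
    edges  : ∀ i → Edge G (vtx i) (vtx (next i))

open Cycle public

-- a cycle of G lies in G[B] iff all its vertices are in B
-- (side v ≡ false means v ∈ B)
CycleIn : ∀ {n} {G : Graph n} → (Fin n → Bool) → Cycle G → Set
CycleIn side C = ∀ i → side (vtx C i) ≡ false

farIndicator : Bool → ℕ
farIndicator true  = 0
farIndicator false = 1

farCount : ∀ {n} {G : Graph n} → NearFar n → Cycle G → ℕ
farCount L C =
  sum (map (λ i → farIndicator (near L (vtx C i) (vtx C (next i))))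
           (allFin (suc (suc (suc (m C))))))

-- The vertices of B are signed so that an edge of G[B] is near exactly when its ends have equal
-- signs (Harary's balance theorem): the sign of v is the parity of the number of far edges on a
-- walk in G[B] to v from a fixed root of its component.  This is independent of the walk because
-- every closed walk in G[B] splits into cycles and edges traversed back and forth, and so has an
-- even number of far edges.  By (iv) each b in B also has a default label, the common label of
-- its edges to A outside M.  A colour is then a function of the side, the sign, the default label
-- and the label of the M-edge, and every threshold condition becomes a finite check on palettes.
module Submission where

open import Defs
open import Data.Bool using (Bool; true; false)
open import Data.Bool.Properties using (¬-not) renaming (_≟_ to _≟ᵇ_)
open import Data.Empty using (⊥-elim)
open import Data.Fin using (Fin; zero; suc; toℕ; fromℕ; fromℕ<; inject₁; inject; Fin′; opposite; #_) renaming (_<_ to _<ᶠ_)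
open import Data.Fin.Properties
  using (any?; toℕ-injective; toℕ-fromℕ<; toℕ-fromℕ; toℕ-inject; toℕ-inject₁; toℕ<n; <-cmp; injective⇒≤; ¬∀⟶∃¬-smallest)
  renaming (_≟_ to _≟ᶠ_)
open import Data.Fin.Relation.Unary.Top using (view; ‵fromℕ; ‵inject₁)
open import Data.List using (tabulate)
open import Data.List.Properties using (map-tabulate; tabulate-cong)
open import Data.Nat using (ℕ; suc; parity; _+_; _≤_; _<_; _>_; z≤n; s≤s; ∣_-_∣; _≤?_; _<?_; _%_)
open import Data.Nat.DivMod using (m%n<n; m<n⇒m%n≡m; n%n≡0)
open import Data.Nat.Divisibility using (_∣_; divides; _∣0; ∣m∣n⇒∣m+n; m∣m*n)
open import Data.Nat.Induction using (<-wellFounded)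
open import Data.Nat.ListAction using (sum)
open import Data.Nat.Properties
  using (+-comm; +-assoc; +-identityʳ; ∣-∣-comm; ≤-trans; m≤n+m; <⇒≤; ≤-reflexive; ∣n-n∣≡0; m<m+n; module ≤-Reasoning)
open import Data.Parity using (Parity; 0ℙ; 1ℙ) renaming (_+_ to _⊕_)
open import Data.Parity.Properties using (+-homo-+; *-homo-*; *-zeroʳ) renaming (_≟_ to _≟ᵖ_)
open import Data.Product using (Σ; ∃; ∃₂; _×_; _,_; proj₁; proj₂; uncurry)
open import Data.Sum using (_⊎_; inj₁; inj₂)
open import Data.Unit using (⊤; tt)
open import Function using (id; _∘_; case_of_)
open import Function.Definitions using (Injective)
open import Induction.WellFounded using (Acc; acc)
open import Relation.Binary.Construct.Closure.ReflexiveTransitive using (Star; ε; _◅_; _◅◅_; revApp; reverse)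
open import Relation.Binary.Definitions using (tri<; tri≈; tri>)
open import Relation.Binary.PropositionalEquality
open import Relation.Nullary using (¬_; Dec; yes; no)
open import Relation.Nullary.Decidable using (_×-dec_; _→-dec_; ¬?; map′; from-yes; decidable-stable)

loop-free : ∀ {n} (G : Graph n) u → ¬ Edge G u u
loop-free G u e with () ← trans (sym e) (adj-irr G u)

inject-fromℕ< : ∀ {m} {i j : Fin m} (i<j : i <ᶠ j) → inject {i = j} (fromℕ< i<j) ≡ i
inject-fromℕ< i<j = toℕ-injective (trans (toℕ-inject (fromℕ< i<j)) (toℕ-fromℕ< i<j))

least-unique : ∀ {m} {P Q : Fin m → Set} → (∀ i → P i → Q i) → (∀ i → Q i → P i) →
               ∀ {i j} → P i → ((k : Fin′ i) → ¬ P (inject k)) → Q j → ((k : Fin′ j) → ¬ Q (inject k)) →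
               i ≡ j
least-unique {P = P} {Q} P⇒Q Q⇒P {i} {j} pi i-least qj j-least with <-cmp i j
... | tri< i<j _ _ = ⊥-elim (j-least (fromℕ< i<j) (subst Q (sym (inject-fromℕ< i<j)) (P⇒Q i pi)))
... | tri≈ _ i≡j _ = i≡j
... | tri> _ _ j<i = ⊥-elim (i-least (fromℕ< j<i) (subst P (sym (inject-fromℕ< j<i)) (Q⇒P j qj)))

sum-tabulate-last : ∀ k (f : Fin (suc k) → ℕ) → sum (tabulate f) ≡ sum (tabulate (f ∘ inject₁)) + f (fromℕ k)
sum-tabulate-last 0 f = +-comm (f zero) 0
sum-tabulate-last (suc k) f =
  trans (cong (f zero +_) (sum-tabulate-last k (f ∘ suc))) (sym (+-assoc (f zero) _ _))

next-fromℕ : ∀ k → next (fromℕ k) ≡ zero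
next-fromℕ k = toℕ-injective (begin
  toℕ (next (fromℕ k))    ≡⟨ toℕ-fromℕ< (m%n<n (suc (toℕ (fromℕ k))) (suc k)) ⟩
  suc (toℕ (fromℕ k)) % suc k ≡⟨ cong (λ i → suc i % suc k) (toℕ-fromℕ k) ⟩
  suc k % suc k           ≡⟨ n%n≡0 (suc k) ⟩
  0                       ∎)
  where open ≡-Reasoning

next-inject₁ : ∀ {k} (j : Fin k) → next (inject₁ j) ≡ suc j
next-inject₁ {k} j = toℕ-injective (begin
  toℕ (next (inject₁ j))        ≡⟨ toℕ-fromℕ< (m%n<n (suc (toℕ (inject₁ j))) (suc k)) ⟩
  suc (toℕ (inject₁ j)) % suc k ≡⟨ cong (λ i → suc i % suc k) (toℕ-inject₁ j) ⟩
  suc (toℕ j) % suc k           ≡⟨ m<n⇒m%n≡m (s≤s (toℕ<n j)) ⟩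
  suc (toℕ j)                   ∎)
  where open ≡-Reasoning

even⇒parity≡0ℙ : ∀ {m} → 2 ∣ m → parity m ≡ 0ℙ
even⇒parity≡0ℙ (divides q refl) = trans (*-homo-* q 2) (*-zeroʳ (parity q))

x⊕[y⊕z]≡0ℙ⇒y≡x⊕z : ∀ x y z → x ⊕ (y ⊕ z) ≡ 0ℙ → y ≡ x ⊕ z
x⊕[y⊕z]≡0ℙ⇒y≡x⊕z 0ℙ 0ℙ 0ℙ _ = refl
x⊕[y⊕z]≡0ℙ⇒y≡x⊕z 0ℙ 1ℙ 1ℙ _ = refl
x⊕[y⊕z]≡0ℙ⇒y≡x⊕z 1ℙ 0ℙ 1ℙ _ = refl
x⊕[y⊕z]≡0ℙ⇒y≡x⊕z 1ℙ 1ℙ 0ℙ _ = refl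
x⊕[y⊕z]≡0ℙ⇒y≡x⊕z 0ℙ 0ℙ 1ℙ ()
x⊕[y⊕z]≡0ℙ⇒y≡x⊕z 0ℙ 1ℙ 0ℙ ()
x⊕[y⊕z]≡0ℙ⇒y≡x⊕z 1ℙ 0ℙ 0ℙ ()
x⊕[y⊕z]≡0ℙ⇒y≡x⊕z 1ℙ 1ℙ 1ℙ ()

∀-Bool? : {P : Bool → Set} → (∀ b → Dec (P b)) → Dec (∀ b → P b)
∀-Bool? P? = map′ (uncurry λ f t → λ { false → f ; true → t }) (λ h → h false , h true) (P? false ×-dec P? true)

∀-Parity? : {P : Parity → Set} → (∀ p → Dec (P p)) → Dec (∀ p → P p)
∀-Parity? P? = map′ (uncurry λ z o → λ { 0ℙ → z ; 1ℙ → o }) (λ h → h 0ℙ , h 1ℙ) (P? 0ℙ ×-dec P? 1ℙ)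

Fits : ℕ → Bool → ℕ → ℕ → Set
Fits t l x y = (l ≡ true → ∣ x - y ∣ ≤ t) × (l ≡ false → ∣ x - y ∣ > t)

fits? : ∀ t l x y → Dec (Fits t l x y)
fits? t l x y = (l ≟ᵇ true →-dec ∣ x - y ∣ ≤? t) ×-dec (l ≟ᵇ false →-dec t <? ∣ x - y ∣)

Fits-sym : ∀ {t l} x y → Fits t l x y → Fits t l y x
Fits-sym x y fits rewrite ∣-∣-comm y x = fits

Fits-refl : ∀ t x → Fits t true x x
Fits-refl t x = (λ _ → subst (_≤ t) (sym (∣n-n∣≡0 x)) z≤n) , λ ()

SignedBy : Bool → Parity → Parity → Set
SignedBy l s s′ = parity (farIndicator l) ≡ s ⊕ s′

module _ {n r : ℕ} (G : Graph n) (L : NearFar n) (side : Fin n → Bool) (t : ℕ) (κ : Fin n → Bool → Fin r) where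

  private
    FitsOn : Fin n → Bool → Fin n → Bool → Set
    FitsOn u a v b = Fits t (near L u v) (toℕ (κ u a)) (toℕ (κ v b))

  threshold-by-sides :
    (∀ u v → Edge G u v → side u ≡ true → side v ≡ true → FitsOn u true v true) →
    (∀ u v → Edge G u v → side u ≡ true → side v ≡ false → FitsOn u true v false) →
    (∀ u v → Edge G u v → side u ≡ false → side v ≡ false → FitsOn u false v false) →
    IsThresholdColoring G L r t (λ v → κ v (side v))
  threshold-by-sides AA AB BB u v e with side u in su | side v in sv
  ... | true  | true  = AA u v e su sv
  ... | true  | false = AB u v e su sv
  ... | false | false = BB u v e su sv
  ... | false | true  rewrite near-sym L u v =
    Fits-sym (toℕ (κ v true)) (toℕ (κ u false)) (AB v u (trans (adj-sym G v u) e) sv su)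

module Walks {n : ℕ} (G : Graph n) (L : NearFar n) (side : Fin n → Bool) where

  BEdge : Fin n → Fin n → Set
  BEdge u v = Edge G u v × side u ≡ false × side v ≡ false

  BEdge-sym : ∀ {u v} → BEdge u v → BEdge v u
  BEdge-sym {u} {v} (e , su , sv) = trans (adj-sym G v u) e , sv , su

  BEdge? : ∀ u v → Dec (BEdge u v)
  BEdge? u v = adj G u v ≟ᵇ true ×-dec side u ≟ᵇ false ×-dec side v ≟ᵇ false

  Walk : Fin n → Fin n → Set
  Walk = Star BEdge

  edgeSum : (Fin n → Fin n → ℕ) → ∀ {u v} → Walk u v → ℕ
  edgeSum h ε = 0
  edgeSum h (_◅_ {u} {w} e p) = h u w + edgeSum h p

  length : ∀ {u v} → Walk u v → ℕ
  length = edgeSum (λ _ _ → 1)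

  far : Fin n → Fin n → ℕ
  far u v = farIndicator (near L u v)

  far-sym : ∀ u v → far u v ≡ far v u
  far-sym u v = cong farIndicator (near-sym L u v)

  weight : ∀ {u v} → Walk u v → ℕ
  weight = edgeSum far

  edgeSum-◅◅ : ∀ h {u w v} (p : Walk u w) (q : Walk w v) → edgeSum h (p ◅◅ q) ≡ edgeSum h p + edgeSum h q
  edgeSum-◅◅ h ε q = refl
  edgeSum-◅◅ h (_◅_ {u} {w} e p) q = trans (cong (h u w +_) (edgeSum-◅◅ h p q)) (sym (+-assoc (h u w) _ _))

  edgeSum-revApp : ∀ h → (∀ u v → h u v ≡ h v u) → ∀ {u w v} (p : Walk w u) (q : Walk w v) →
                   edgeSum h (revApp BEdge-sym p q) ≡ edgeSum h p + edgeSum h q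
  edgeSum-revApp h h-sym ε q = refl
  edgeSum-revApp h h-sym (_◅_ {w} {x} e p) q = begin
    edgeSum h (revApp BEdge-sym p (BEdge-sym e ◅ q)) ≡⟨ edgeSum-revApp h h-sym p _ ⟩
    edgeSum h p + (h x w + edgeSum h q)               ≡⟨ cong (λ c → edgeSum h p + (c + edgeSum h q)) (h-sym x w) ⟩
    edgeSum h p + (h w x + edgeSum h q)               ≡⟨ sym (+-assoc (edgeSum h p) _ _) ⟩
    edgeSum h p + h w x + edgeSum h q                 ≡⟨ cong (_+ edgeSum h q) (+-comm (edgeSum h p) (h w x)) ⟩
    h w x + edgeSum h p + edgeSum h q                 ∎
    where open ≡-Reasoning

  weight-reverse : ∀ {u v} (p : Walk u v) → weight (reverse BEdge-sym p) ≡ weight p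
  weight-reverse p = trans (edgeSum-revApp far far-sym p ε) (+-identityʳ (weight p))

  vertex : ∀ {u v} (p : Walk u v) → Fin (suc (length p)) → Fin n
  vertex {u} p zero = u
  vertex (e ◅ p) (suc i) = vertex p i

  vertex-last : ∀ {u v} (p : Walk u v) → vertex p (fromℕ (length p)) ≡ v
  vertex-last ε = refl
  vertex-last (e ◅ p) = vertex-last p

  vertex-step : ∀ {u v} (p : Walk u v) (j : Fin (length p)) → BEdge (vertex p (inject₁ j)) (vertex p (suc j))
  vertex-step (e ◅ p) zero = e
  vertex-step (e ◅ p) (suc j) = vertex-step p j

  vertex-in-B : ∀ {u v} (p : Walk u v) → side u ≡ false → ∀ i → side (vertex p i) ≡ false
  vertex-in-B p su zero = su
  vertex-in-B (e ◅ p) _ (suc i) = vertex-in-B p (proj₂ (proj₂ e)) i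

  edgeSum-tabulate : ∀ h {u v} (p : Walk u v) →
                     sum (tabulate λ j → h (vertex p (inject₁ j)) (vertex p (suc j))) ≡ edgeSum h p
  edgeSum-tabulate h ε = refl
  edgeSum-tabulate h (_◅_ {u} {w} e p) = cong (h u w +_) (edgeSum-tabulate h p)

  _∈ᵥ_ : ∀ {u v} → Fin n → Walk u v → Set
  x ∈ᵥ p = ∃ λ i → vertex p i ≡ x

  _∈ᵥ?_ : ∀ {u v} x (p : Walk u v) → Dec (x ∈ᵥ p)
  x ∈ᵥ? p = any? (λ i → vertex p i ≟ᶠ x)

  Simple : ∀ {u v} → Walk u v → Set
  Simple ε = ⊤
  Simple (_◅_ {u} e p) = ¬ (u ∈ᵥ p) × Simple p

  simple⇒injective : ∀ {u v} (p : Walk u v) → Simple p → Injective _≡_ _≡_ (vertex p)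
  simple⇒injective ε _ {zero} {zero} _ = refl
  simple⇒injective (e ◅ p) _ {zero} {zero} _ = refl
  simple⇒injective (e ◅ p) (u∉p , _) {zero} {suc j} u≡ = ⊥-elim (u∉p (j , sym u≡))
  simple⇒injective (e ◅ p) (u∉p , _) {suc i} {zero} ≡u = ⊥-elim (u∉p (i , ≡u))
  simple⇒injective (e ◅ p) (_ , simple) {suc i} {suc j} eq = cong suc (simple⇒injective p simple eq)

  simple⇒length<n : ∀ {u v} (p : Walk u v) → Simple p → length p < n
  simple⇒length<n p simple = injective⇒≤ (simple⇒injective p simple)

  cut : ∀ {u v} (p : Walk u v) (i : Fin (suc (length p))) →
        ∃₂ λ (a : Walk u (vertex p i)) (b : Walk (vertex p i) v) → p ≡ a ◅◅ b
  cut p zero = ε , p , refl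
  cut (e ◅ p) (suc i) with cut p i
  ... | a , b , p≡ab = e ◅ a , b , cong (e ◅_) p≡ab

  record Loop {u v} (p : Walk u v) : Set where
    constructor loop
    field
      {x}      : Fin n
      before   : Walk u x
      detour   : Walk x x
      after    : Walk x v
      nonempty : 0 < length detour
      split-eq : p ≡ before ◅◅ detour ◅◅ after

    shortcut : Walk u v
    shortcut = before ◅◅ after

    edgeSum-split : ∀ h → edgeSum h p ≡ edgeSum h shortcut + edgeSum h detour
    edgeSum-split h = begin
      edgeSum h p                                   ≡⟨ cong (edgeSum h) split-eq ⟩
      edgeSum h (before ◅◅ detour ◅◅ after)         ≡⟨ edgeSum-◅◅ h before _ ⟩
      eb + edgeSum h (detour ◅◅ after)              ≡⟨ cong (eb +_) (edgeSum-◅◅ h detour after) ⟩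
      eb + (ed + ea)                                ≡⟨ cong (eb +_) (+-comm ed ea) ⟩
      eb + (ea + ed)                                ≡⟨ sym (+-assoc eb ea ed) ⟩
      eb + ea + ed                                  ≡⟨ cong (_+ ed) (sym (edgeSum-◅◅ h before after)) ⟩
      edgeSum h shortcut + ed                       ∎
      where
      open ≡-Reasoning
      eb = edgeSum h before
      ed = edgeSum h detour
      ea = edgeSum h after

    shortcut-shorter : length shortcut < length p
    shortcut-shorter = begin-strict
      length shortcut                  <⟨ m<m+n (length shortcut) nonempty ⟩
      length shortcut + length detour ≡⟨ sym (edgeSum-split _) ⟩
      length p                         ∎
      where open ≤-Reasoning

    detour-shorter : length detour ≤ length p
    detour-shorter = ≤-trans (m≤n+m (length detour) (length shortcut)) (≤-reflexive (sym (edgeSum-split _)))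

  loop-at : ∀ {u w v} (e : BEdge u w) (p : Walk w v) (i : Fin (suc (length p))) → vertex p i ≡ u → Loop (e ◅ p)
  loop-at e p i refl with cut p i
  ... | a , b , p≡ab = loop ε (e ◅ a) b (s≤s z≤n) (cong (e ◅_) p≡ab)

  split : ∀ {u v} (p : Walk u v) → Simple p ⊎ Loop p
  split ε = inj₁ tt
  split (_◅_ {u} e p) with split p
  ... | inj₂ (loop a d b nonempty p≡adb) = inj₂ (loop (e ◅ a) d b nonempty (cong (e ◅_) p≡adb))
  ... | inj₁ simple with u ∈ᵥ? p
  ...   | no u∉p = inj₁ (u∉p , simple)
  ...   | yes (i , vertex≡u) = inj₂ (loop-at e p i vertex≡u)

  simplify : ∀ {u v} (p : Walk u v) → Acc _<_ (length p) → Σ (Walk u v) Simple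
  simplify p (acc smaller) with split p
  ... | inj₁ simple = p , simple
  ... | inj₂ l = simplify (Loop.shortcut l) (smaller (Loop.shortcut-shorter l))

  -- Bounding the length keeps reachability decidable, so that every v has a least vertex reaching
  -- it, its root; by reach-within-n the bound loses nothing.
  Reach : ℕ → Fin n → Fin n → Set
  Reach k x v = Σ (Walk x v) λ p → length p ≤ k

  reach? : ∀ k x v → Dec (Reach k x v)
  reach? 0 x v with x ≟ᶠ v
  ... | yes refl = yes (ε , z≤n)
  ... | no x≢v = no λ { (ε , _) → x≢v refl ; (_ ◅ _ , ()) }
  reach? (suc k) x v with x ≟ᶠ v
  ... | yes refl = yes (ε , z≤n)
  ... | no x≢v with any? (λ w → BEdge? x w ×-dec reach? k w v)
  ...   | yes (w , e , p , p≤k) = yes (e ◅ p , s≤s p≤k)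
  ...   | no ¬step = no λ { (ε , _) → x≢v refl ; (e ◅ p , s≤s p≤k) → ¬step (_ , e , p , p≤k) }

  reach-within-n : ∀ {x v} → Walk x v → Reach n x v
  reach-within-n p with simplify p (<-wellFounded _)
  ... | q , simple = q , <⇒≤ (simple⇒length<n q simple)

  root-spec : ∀ v → ∃ λ r → Reach n r v × ((j : Fin′ r) → ¬ Reach n (inject j) v)
  root-spec v with ¬∀⟶∃¬-smallest n (λ x → ¬ Reach n x v) (λ x → ¬? (reach? n x v)) (λ unreachable → unreachable v (ε , z≤n))
  ... | r , reachable , below = r , decidable-stable (reach? n r v) reachable , below

  root : Fin n → Fin n
  root v = proj₁ (root-spec v)

  rootWalk : ∀ v → Walk (root v) v
  rootWalk v = proj₁ (proj₁ (proj₂ (root-spec v)))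

  root-adjacent : ∀ {u v} → BEdge u v → root u ≡ root v
  root-adjacent {u} {v} e =
    least-unique {P = λ x → Reach n x u} {Q = λ x → Reach n x v} (λ _ → extend e) (λ _ → extend (BEdge-sym e))
      (proj₁ (proj₂ (root-spec u))) (proj₂ (proj₂ (root-spec u)))
      (proj₁ (proj₂ (root-spec v))) (proj₂ (proj₂ (root-spec v)))
    where
    extend : ∀ {x a b} → BEdge a b → Reach n x a → Reach n x b
    extend e (p , _) = reach-within-n (p ◅◅ e ◅ ε)

  module Balanced (B-balanced : (C : Cycle G) → CycleIn side C → 2 ∣ farCount L C) where

    cycle-even : ∀ {u w} (e : BEdge u w) (p : Walk w u) → Simple p → 2 ≤ length p → 2 ∣ weight (e ◅ p)
    cycle-even e (_ ◅ ε) _ (s≤s ())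
    cycle-even {u} {w} e p@(_ ◅ _ ◅ q) simple _ =
      subst (2 ∣_) farCount≡weight (B-balanced C (vertex-in-B p (proj₂ (proj₂ e))))
      where
      cycle-edges : ∀ i → Edge G (vertex p i) (vertex p (next i))
      cycle-edges i with view i
      ... | ‵fromℕ = subst₂ (Edge G) (sym (vertex-last p)) (cong (vertex p) (sym (next-fromℕ _))) (proj₁ e)
      ... | ‵inject₁ j =
        subst (Edge G (vertex p (inject₁ j))) (cong (vertex p) (sym (next-inject₁ j))) (proj₁ (vertex-step p j))

      C : Cycle G
      C = record { m = length q ; vtx = vertex p ; inj = simple⇒injective p simple ; edges = cycle-edges }

      g : Fin (suc (length p)) → ℕ
      g i = far (vertex p i) (vertex p (next i))

      farCount≡weight : farCount L C ≡ weight (e ◅ p)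
      farCount≡weight = begin
        farCount L C                                   ≡⟨ cong sum (map-tabulate id g) ⟩
        sum (tabulate g)                               ≡⟨ sum-tabulate-last (length p) g ⟩
        sum (tabulate (g ∘ inject₁)) + g (fromℕ (length p))
          ≡⟨ cong₂ _+_ (cong sum (tabulate-cong λ j → cong (far (vertex p (inject₁ j)) ∘ vertex p) (next-inject₁ j)))
                       (cong₂ far (vertex-last p) (cong (vertex p) (next-fromℕ (length p)))) ⟩
        sum (tabulate λ j → far (vertex p (inject₁ j)) (vertex p (suc j))) + far u w
          ≡⟨ cong (_+ far u w) (edgeSum-tabulate far p) ⟩
        weight p + far u w                             ≡⟨ +-comm (weight p) (far u w) ⟩
        weight (e ◅ p)                                 ∎
        where open ≡-Reasoning

    simple-closed-even : ∀ {u w} (e : BEdge u w) (p : Walk w u) → Simple p → 2 ∣ weight (e ◅ p)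
    simple-closed-even {u} e ε _ = ⊥-elim (loop-free G u (proj₁ e))
    simple-closed-even {u} {w} e (_ ◅ ε) _ rewrite far-sym w u = m∣m*n (far u w)
    simple-closed-even e p@(_ ◅ _ ◅ _) simple = cycle-even e p simple (s≤s (s≤s z≤n))

    closed-even : ∀ {u} (c : Walk u u) → Acc _<_ (length c) → 2 ∣ weight c
    closed-even ε _ = 2 ∣0
    closed-even (_◅_ {u} {w} e p) (acc smaller) with split p
    ... | inj₁ simple = simple-closed-even e p simple
    ... | inj₂ l = subst (2 ∣_) (sym weight≡) (∣m∣n⇒∣m+n
        (closed-even (e ◅ shortcut) (smaller (s≤s shortcut-shorter)))
        (closed-even detour (smaller (s≤s detour-shorter))))
      where
      open Loop l
      weight≡ : weight (e ◅ p) ≡ weight (e ◅ shortcut) + weight detour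
      weight≡ = trans (cong (far u w +_) (edgeSum-split far)) (sym (+-assoc (far u w) _ _))

    edge-parity : ∀ {r u v} (e : BEdge u v) (p : Walk r u) (q : Walk r v) →
                  parity (far u v) ≡ parity (weight p) ⊕ parity (weight q)
    edge-parity {u = u} {v} e p q = x⊕[y⊕z]≡0ℙ⇒y≡x⊕z (parity (weight p)) (parity (far u v)) (parity (weight q)) (begin
      parity (weight p) ⊕ (parity (far u v) ⊕ parity (weight q))
        ≡⟨ cong (parity (weight p) ⊕_) (sym (+-homo-+ (far u v) _)) ⟩
      parity (weight p) ⊕ parity (far u v + weight q)
        ≡⟨ sym (+-homo-+ (weight p) _) ⟩
      parity (weight p + (far u v + weight q))
        ≡⟨ cong (λ k → parity (weight p + (far u v + k))) (sym (weight-reverse q)) ⟩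
      parity (weight p + weight (e ◅ reverse BEdge-sym q))
        ≡⟨ cong parity (sym (edgeSum-◅◅ far p _)) ⟩
      parity (weight (p ◅◅ e ◅ reverse BEdge-sym q))
        ≡⟨ even⇒parity≡0ℙ (closed-even (p ◅◅ e ◅ reverse BEdge-sym q) (<-wellFounded _)) ⟩
      0ℙ ∎)
      where open ≡-Reasoning

    sign : Fin n → Parity
    sign v = parity (weight (rootWalk v))

    sign-edge : ∀ {u v} → BEdge u v → SignedBy (near L u v) (sign u) (sign v)
    sign-edge {u} {v} e = from-common-root (root-adjacent e) (rootWalk u) (rootWalk v)
      where
      from-common-root : ∀ {r r′} → r ≡ r′ → (p : Walk r u) (q : Walk r′ v) →
                         parity (far u v) ≡ parity (weight p) ⊕ parity (weight q)
      from-common-root refl = edge-parity e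

mirror : ∀ {k} → Parity → Fin k → Fin k
mirror 0ℙ = id
mirror 1ℙ = opposite

-- A vertex of B with sign s, default label d and matching-edge label l (l = d when unmatched) is
-- coloured in 0–3, mirrored to 9–12 when s = 1ℙ, so that edges inside B are near iff the signs
-- agree.  A vertex of A gets 6, or if matched a colour in 5–7 fitting its matching edge; every
-- colour in 5–7 fits the edges to A and to unmatched vertices of B (colours 0, 3, 9, 12).
colourB₁₃ : Parity → Bool → Bool → Fin 13
colourB₁₃ s d l = mirror s (base d l)
  where
  base : Bool → Bool → Fin 13
  base true  true  = # 3
  base true  false = # 2
  base false true  = # 1
  base false false = # 0

colourA₁₃ : Parity → Bool → Bool → Fin 13
colourA₁₃ s d l = mirror s (base d l)
  where
  base : Bool → Bool → Fin 13
  base true  true  = # 6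
  base true  false = # 7
  base false true  = # 5
  base false false = # 6

colourB₅ : Parity → Bool → Fin 5
colourB₅ s true  = mirror s (# 1)
colourB₅ s false = mirror s (# 0)

B-edge-fits₁₃ : ∀ l s s′ d d′ k k′ → SignedBy l s s′ →
                Fits 4 l (toℕ (colourB₁₃ s d k)) (toℕ (colourB₁₃ s′ d′ k′))
B-edge-fits₁₃ = from-yes (∀-Bool? λ l → ∀-Parity? λ s → ∀-Parity? λ s′ → ∀-Bool? λ d → ∀-Bool? λ d′ →
  ∀-Bool? λ k → ∀-Bool? λ k′ → (parity (farIndicator l) ≟ᵖ s ⊕ s′) →-dec
  fits? 4 l (toℕ (colourB₁₃ s d k)) (toℕ (colourB₁₃ s′ d′ k′)))

matching-edge-fits₁₃ : ∀ s d l → Fits 4 l (toℕ (colourA₁₃ s d l)) (toℕ (colourB₁₃ s d l))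
matching-edge-fits₁₃ = from-yes (∀-Parity? λ s → ∀-Bool? λ d → ∀-Bool? λ l →
  fits? 4 l (toℕ (colourA₁₃ s d l)) (toℕ (colourB₁₃ s d l)))

matched-A-fits₁₃ : ∀ s′ d′ l′ s d → Fits 4 d (toℕ (colourA₁₃ s′ d′ l′)) (toℕ (colourB₁₃ s d d))
matched-A-fits₁₃ = from-yes (∀-Parity? λ s′ → ∀-Bool? λ d′ → ∀-Bool? λ l′ → ∀-Parity? λ s → ∀-Bool? λ d →
  fits? 4 d (toℕ (colourA₁₃ s′ d′ l′)) (toℕ (colourB₁₃ s d d)))

unmatched-A-fits₁₃ : ∀ s d l → Fits 4 d 6 (toℕ (colourB₁₃ s d l))
unmatched-A-fits₁₃ = from-yes (∀-Parity? λ s → ∀-Bool? λ d → ∀-Bool? λ l →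
  fits? 4 d 6 (toℕ (colourB₁₃ s d l)))

A-edge-fits₁₃ : ∀ s d l → Fits 4 true (toℕ (colourA₁₃ s d l)) 6
A-edge-fits₁₃ = from-yes (∀-Parity? λ s → ∀-Bool? λ d → ∀-Bool? λ l →
  fits? 4 true (toℕ (colourA₁₃ s d l)) 6)

A-fits₅ : ∀ s d → Fits 1 d 2 (toℕ (colourB₅ s d))
A-fits₅ = from-yes (∀-Parity? λ s → ∀-Bool? λ d → fits? 1 d 2 (toℕ (colourB₅ s d)))

B-edge-fits₅ : ∀ l s s′ d d′ → SignedBy l s s′ → Fits 1 l (toℕ (colourB₅ s d)) (toℕ (colourB₅ s′ d′))
B-edge-fits₅ = from-yes (∀-Bool? λ l → ∀-Parity? λ s → ∀-Parity? λ s′ → ∀-Bool? λ d → ∀-Bool? λ d′ →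
  (parity (farIndicator l) ≟ᵖ s ⊕ s′) →-dec fits? 1 l (toℕ (colourB₅ s d)) (toℕ (colourB₅ s′ d′)))

module Colourings {n : ℕ} (G : Graph n) (L : NearFar n) (side : Fin n → Bool) (M : Fin n → Fin n → Bool)
  (M-sym : ∀ u v → M u v ≡ M v u)
  (M⊆E : ∀ u v → M u v ≡ true → Edge G u v)
  (A-near : ∀ u v → side u ≡ true → side v ≡ true → Edge G u v → near L u v ≡ true)
  (B-balanced : (C : Cycle G) → CycleIn side C → 2 ∣ farCount L C)
  (M-induced : ∀ u v x y → M u v ≡ true → M x y ≡ true →
               ¬ ((u ≡ x × v ≡ y) ⊎ (u ≡ y × v ≡ x)) →
               (u ≢ x × ¬ Edge G u x) × (u ≢ y × ¬ Edge G u y) ×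
               (v ≢ x × ¬ Edge G v x) × (v ≢ y × ¬ Edge G v y))
  (M-crossing : ∀ u v → M u v ≡ true → side u ≢ side v)
  (A-uniform : ∀ a a′ b → side a ≡ true → side a′ ≡ true → side b ≡ false →
               Edge G a b → Edge G a′ b → M a b ≡ false → M a′ b ≡ false →
               near L a b ≡ near L a′ b) where

  open Walks.Balanced G L side B-balanced using (sign; sign-edge)

  partner-unique : ∀ {v w w′} → M v w ≡ true → M v w′ ≡ true → w ≡ w′
  partner-unique {v} {w} {w′} m m′ with w ≟ᶠ w′
  ... | yes w≡w′ = w≡w′
  ... | no w≢w′ = ⊥-elim (proj₁ (proj₁ (M-induced v w v w′ m m′ distinct)) refl)
    where
    distinct : ¬ ((v ≡ v × w ≡ w′) ⊎ (v ≡ w′ × w ≡ v))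
    distinct (inj₁ (_ , w≡w′)) = w≢w′ w≡w′
    distinct (inj₂ (refl , _)) = loop-free G v (M⊆E v v m′)

  matched-nonadjacent : ∀ {u w v w′} → M u w ≡ true → M v w′ ≡ true → u ≢ v → w ≢ v → ¬ Edge G u v
  matched-nonadjacent {u} {w} {v} {w′} m m′ u≢v w≢v = proj₂ (proj₁ (M-induced u w v w′ m m′ distinct))
    where
    distinct : ¬ ((u ≡ v × w ≡ w′) ⊎ (u ≡ w′ × w ≡ v))
    distinct (inj₁ (u≡v , _)) = u≢v u≡v
    distinct (inj₂ (_ , w≡v)) = w≢v w≡v

  data Partner (v : Fin n) : Set where
    matched   : ∀ w → M v w ≡ true → Partner v
    unmatched : (∀ w → M v w ≡ false) → Partner v

  partner : ∀ v → Partner v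
  partner v with any? (λ w → M v w ≟ᵇ true)
  ... | yes (w , m) = matched w m
  ... | no none = unmatched (λ w → ¬-not (λ m → none (w , m)))

  ANeighbourOutsideM : Fin n → Fin n → Set
  ANeighbourOutsideM b a = side a ≡ true × Edge G a b × M a b ≡ false

  ANeighbourOutsideM? : ∀ b → Dec (∃ (ANeighbourOutsideM b))
  ANeighbourOutsideM? b = any? λ a → side a ≟ᵇ true ×-dec adj G a b ≟ᵇ true ×-dec M a b ≟ᵇ false

  labelFrom : ∀ {b} → Dec (∃ (ANeighbourOutsideM b)) → Bool
  labelFrom {b} (yes (a , _)) = near L a b
  labelFrom (no _) = true

  defaultLabel : Fin n → Bool
  defaultLabel b = labelFrom (ANeighbourOutsideM? b)

  near≡defaultLabel : ∀ {a b} → side b ≡ false → ANeighbourOutsideM b a → near L a b ≡ defaultLabel b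
  near≡defaultLabel {a} {b} sb (sa , e , m) = from (ANeighbourOutsideM? b)
    where
    from : (found : Dec (∃ (ANeighbourOutsideM b))) → near L a b ≡ labelFrom found
    from (yes (a′ , sa′ , e′ , m′)) = A-uniform a a′ b sa sa′ sb e e′ m m′
    from (no none) = ⊥-elim (none (a , sa , e , m))

  matchingLabel : ∀ v → Partner v → Bool
  matchingLabel v (matched w _) = near L w v
  matchingLabel v (unmatched _) = defaultLabel v

  matchingLabel-matched : ∀ {u v} → M v u ≡ true → (pv : Partner v) → matchingLabel v pv ≡ near L u v
  matchingLabel-matched m (matched w m′) rewrite partner-unique m′ m = refl
  matchingLabel-matched {u} m (unmatched none) with () ← trans (sym m) (none u)

  colour₁₃ : ∀ v → Bool → Partner v → Fin 13
  colour₁₃ v true  (matched w _) = colourA₁₃ (sign w) (defaultLabel w) (near L v w)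
  colour₁₃ v true  (unmatched _) = # 6
  colour₁₃ v false pv            = colourB₁₃ (sign v) (defaultLabel v) (matchingLabel v pv)

  sides-differ : ∀ {u v} → side u ≡ true → side v ≡ false → u ≢ v
  sides-differ su sv refl with () ← trans (sym su) sv

  A-edge₁₃ : ∀ u v → Edge G u v → side u ≡ true → side v ≡ true → (pu : Partner u) (pv : Partner v) →
             Fits 4 (near L u v) (toℕ (colour₁₃ u true pu)) (toℕ (colour₁₃ v true pv))
  A-edge₁₃ u v e su sv (matched w m) (matched w′ m′) =
    ⊥-elim (matched-nonadjacent m m′ (λ { refl → loop-free G u e }) (λ { refl → M-crossing u v m (trans su (sym sv)) }) e)
  A-edge₁₃ u v e su sv (matched w _) (unmatched _) rewrite A-near u v su sv e =
    A-edge-fits₁₃ (sign w) (defaultLabel w) (near L u w)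
  A-edge₁₃ u v e su sv (unmatched _) (matched w _) rewrite A-near u v su sv e =
    Fits-sym (toℕ (colourA₁₃ (sign w) (defaultLabel w) (near L v w))) 6 (A-edge-fits₁₃ (sign w) (defaultLabel w) (near L v w))
  A-edge₁₃ u v e su sv (unmatched _) (unmatched _) rewrite A-near u v su sv e = Fits-refl 4 6

  AB-edge₁₃ : ∀ u v → Edge G u v → side u ≡ true → side v ≡ false → (pu : Partner u) (pv : Partner v) →
              Fits 4 (near L u v) (toℕ (colour₁₃ u true pu)) (toℕ (colour₁₃ v false pv))
  AB-edge₁₃ u v e su sv pu pv with M u v in muv
  AB-edge₁₃ u v e su sv (matched w m) pv | true
    rewrite partner-unique m muv | matchingLabel-matched (trans (M-sym v u) muv) pv =
    matching-edge-fits₁₃ (sign v) (defaultLabel v) (near L u v)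
  AB-edge₁₃ u v e su sv (unmatched none) pv | true with () ← trans (sym muv) (none v)
  AB-edge₁₃ u v e su sv (matched w m) (matched w′ m′) | false =
    ⊥-elim (matched-nonadjacent m m′ (sides-differ su sv) (λ { refl → case trans (sym m) muv of λ () }) e)
  AB-edge₁₃ u v e su sv (matched w _) (unmatched _) | false rewrite near≡defaultLabel sv (su , e , muv) =
    matched-A-fits₁₃ (sign w) (defaultLabel w) (near L u w) (sign v) (defaultLabel v)
  AB-edge₁₃ u v e su sv (unmatched _) pv | false rewrite near≡defaultLabel sv (su , e , muv) =
    unmatched-A-fits₁₃ (sign v) (defaultLabel v) (matchingLabel v pv)

  B-edge₁₃ : ∀ u v → Edge G u v → side u ≡ false → side v ≡ false → (pu : Partner u) (pv : Partner v) →
             Fits 4 (near L u v) (toℕ (colour₁₃ u false pu)) (toℕ (colour₁₃ v false pv))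
  B-edge₁₃ u v e su sv pu pv =
    B-edge-fits₁₃ (near L u v) (sign u) (sign v) (defaultLabel u) (defaultLabel v) (matchingLabel u pu) (matchingLabel v pv)
      (sign-edge (e , su , sv))

  threshold-colouring₁₃ : HasThresholdColoring G L 13 4
  threshold-colouring₁₃ = (λ v → colour₁₃ v (side v) (partner v)) ,
    threshold-by-sides G L side 4 (λ v b → colour₁₃ v b (partner v))
      (λ u v e su sv → A-edge₁₃ u v e su sv (partner u) (partner v))
      (λ u v e su sv → AB-edge₁₃ u v e su sv (partner u) (partner v))
      (λ u v e su sv → B-edge₁₃ u v e su sv (partner u) (partner v))

  colour₅ : Fin n → Bool → Fin 5
  colour₅ v true  = # 2
  colour₅ v false = colourB₅ (sign v) (defaultLabel v)

  threshold-colouring₅ : (∀ u v → M u v ≡ false) → HasThresholdColoring G L 5 1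
  threshold-colouring₅ M-empty = (λ v → colour₅ v (side v)) , threshold-by-sides G L side 1 colour₅
    (λ u v e su sv → subst (λ l → Fits 1 l 2 2) (sym (A-near u v su sv e)) (Fits-refl 1 2))
    (λ u v e su sv → subst (λ l → Fits 1 l 2 (toℕ (colour₅ v false)))
                           (sym (near≡defaultLabel sv (su , e , M-empty u v))) (A-fits₅ (sign v) (defaultLabel v)))
    (λ u v e su sv → B-edge-fits₅ (near L u v) (sign u) (sign v) (defaultLabel u) (defaultLabel v) (sign-edge (e , su , sv)))

lemma2 : ∀ {n} (G : Graph n) (L : NearFar n)
           (side : Fin n → Bool)
           (M : Fin n → Fin n → Bool) →
           (∀ u v → M u v ≡ M v u) →
           (∀ u v → M u v ≡ true → Edge G u v) →
           (∀ u v → side u ≡ true → side v ≡ true → Edge G u v → near L u v ≡ true) →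
           ((C : Cycle G) → CycleIn side C → 2 ∣ farCount L C) →
           (∀ u v x y → M u v ≡ true → M x y ≡ true →
              ¬ ((u ≡ x × v ≡ y) ⊎ (u ≡ y × v ≡ x)) →
              (u ≢ x × ¬ Edge G u x) × (u ≢ y × ¬ Edge G u y) ×
              (v ≢ x × ¬ Edge G v x) × (v ≢ y × ¬ Edge G v y)) →
           (∀ u v → M u v ≡ true → side u ≢ side v) →
           (∀ a a′ b → side a ≡ true → side a′ ≡ true → side b ≡ false →
              Edge G a b → Edge G a′ b → M a b ≡ false → M a′ b ≡ false →
              near L a b ≡ near L a′ b) →
           HasThresholdColoring G L 13 4 ×
           ((∀ u v → M u v ≡ false) → HasThresholdColoring G L 5 1)
lemma2 G L side M M-sym M⊆E A-near B-balanced M-induced M-crossing A-uniform =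
  threshold-colouring₁₃ , threshold-colouring₅
  where open Colourings G L side M M-sym M⊆E A-near B-balanced M-induced M-crossing A-uniform
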